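{- Let $Q$ be an orbit-finite equivariant set with the integer atoms. There exists a mapping $\Phi\mapsto\,\equiv_\Phi$ from equivalence signatures on $Q$ to equivariant equivalence relations on $Q$ such that for every equivariant equivalence relation $\equiv$ on $Q$ and every signature $\Phi_\equiv$ of $\equiv$ (for any choice of the integer representatives of its $\mathrm{diff}$ values), $\equiv_{\Phi_\equiv}\;=\;\equiv$.
   Context: Integer atoms: the atoms are the integers $\mathbb{Z}$ with the successor function; the automorphisms are exactly the translations $x\mapsto x+z$, acting hereditarily on sets built from atoms. A set, relation or function is equivariant if invariant under all translations; an equivariant set is orbit-finite if it is a finite union of orbits. For $k\ge1$, $\mathbb{Z}_k$ is the integers modulo $k$ with translations acting by addition, $\mathbb{Z}_0=\mathbb{Z}$; every equivariant single-orbit set is equivariantly isomorphic to $\mathbb{Z}_k$ for a unique $k\in\mathbb{N}$ (its characteristic). For each orbit $\tau$ of $Q$, of characteristic $k_\tau$, fix an equivariant isomorphism $\mathbb{Z}_{k_\tau}\to\tau$ and write $(\tau,i)$ for the image of $i \bmod k_\tau$, and $0_\tau=(\tau,0)$. Signature of an equivariant equivalence $\equiv$ on $Q$: its equivalence type $[\equiv]$ is the relation on orbits of $Q$ given by $\tau[\equiv]\sigma$ iff $q_1\equiv q_2$ for some $q_1\in\tau$, $q_2\in\sigma$ (an equivalence relation). Let $f:Q\to Q/\!\equiv$ be the (equivariant) quotient map; orbits of $Q/\!\equiv$ correspond to classes $\Sigma$ of $[\equiv]$; $\mathrm{char}(\Sigma)\in\mathbb{N}$ is the characteristic of the corresponding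 orbit. For $\tau,\sigma\in\Sigma$, $\mathrm{diff}(\tau,\sigma)$ is any integer representative of $f(0_\sigma)-f(0_\tau)\in\mathbb{Z}_{\mathrm{char}(\Sigma)}$ (computed via any equivariant isomorphism of that orbit with $\mathbb{Z}_{\mathrm{char}(\Sigma)}$; the value is independent of that choice). A signature of $\equiv$ is $\Phi_\equiv=([\equiv],\mathrm{diff},\mathrm{char})$. An equivalence signature on $Q$ is a triple $(\sim,\mathrm{diff},\mathrm{char})$ where $\sim$ is an equivalence relation on the orbits of $Q$, $\mathrm{diff}$ assigns an integer to each pair $(\tau,\sigma)$ with $\tau\sim\sigma$, and $\mathrm{char}$ assigns a natural number to each class of $\sim$, such that for each class $\Sigma$: $\mathrm{diff}(\tau_1,\tau_2)+\mathrm{diff}(\tau_2,\tau_3)\equiv\mathrm{diff}(\tau_1,\tau_3)\pmod{\mathrm{char}(\Sigma)}$ for all $\tau_1,\tau_2,\tau_3\in\Sigma$, and $k_\tau\equiv0\pmod{\mathrm{char}(\Sigma)}$ for all $\tau\in\Sigma$. (Congruence modulo $0$ means equality.) -}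

module Defs where

open import Data.Nat using (ℕ)
open import Data.Integer using (ℤ; +_; _+_; _-_)
open import Data.Integer.Divisibility using (_∣_)
open import Data.Fin using (Fin)
open import Data.Product using (Σ; ∃; ∃-syntax; _×_)
open import Function.Bundles using (_⇔_)
open import Relation.Binary.PropositionalEquality using (_≡_)

-- Congruence modulo k (k = 0 means equality): k divides (a - b).
_≡[mod_]_ : ℤ → ℕ → ℤ → Set
a ≡[mod k ] b = (+ k) ∣ (a - b)

-- An orbit-finite equivariant set Q with integer atoms, given (via the fixed
-- equivariant isomorphisms Z_{k_τ} → τ) by its number of orbits n and the
-- characteristics k : Fin n → ℕ.  An element (τ , i) of Q is an orbit τ and
-- an integer representative i of an element of Z_{k τ}; (τ , i) and (τ , i')
-- denote the same element iff i ≡ i' (mod k τ).  Translation by z maps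
-- (τ , i) to (τ , i + z).

QRel : ℕ → Set₁
QRel n = Fin n → ℤ → Fin n → ℤ → Set

record IsEquivariantEquivalence {n : ℕ} (k : Fin n → ℕ) (R : QRel n) : Set where
  field
    wellDefined : ∀ {τ σ i i' j j'} → i ≡[mod k τ ] i' → j ≡[mod k σ ] j' →
                  R τ i σ j → R τ i' σ j'
    refl  : ∀ τ i → R τ i τ i
    sym   : ∀ {τ i σ j} → R τ i σ j → R σ j τ i
    trans : ∀ {τ i σ j ρ l} → R τ i σ j → R σ j ρ l → R τ i ρ l
    equivariant : ∀ {τ i σ j} (z : ℤ) → R τ i σ j → R τ (i + z) σ (j + z)

-- Raw data of a signature: relation on orbits, diff (only meaningful on
-- related pairs), char (given per orbit, constant on classes, i.e. one value
-- per class).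
record SigData (n : ℕ) : Set₁ where
  field
    sim  : Fin n → Fin n → Set
    diff : Fin n → Fin n → ℤ
    char : Fin n → ℕ

record IsEquivSignature {n : ℕ} (k : Fin n → ℕ) (Φ : SigData n) : Set where
  open SigData Φ
  field
    sim-refl  : ∀ τ → sim τ τ
    sim-sym   : ∀ {τ σ} → sim τ σ → sim σ τ
    sim-trans : ∀ {τ σ ρ} → sim τ σ → sim σ ρ → sim τ ρ
    char-class : ∀ {τ σ} → sim τ σ → char τ ≡ char σ
    cocycle : ∀ {τ₁ τ₂ τ₃} → sim τ₁ τ₂ → sim τ₂ τ₃ →
              (diff τ₁ τ₂ + diff τ₂ τ₃) ≡[mod char τ₁ ] diff τ₁ τ₃
    char-divides : ∀ τ → (+ k τ) ≡[mod char τ ] (+ 0)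

record EquivSignature {n : ℕ} (k : Fin n → ℕ) : Set₁ where
  field
    dat   : SigData n
    isSig : IsEquivSignature k dat
  open SigData dat public

-- Φ is a signature of the equivariant equivalence R.
--  * sim is the equivalence type [R]: τ [R] σ iff some q₁ ∈ τ, q₂ ∈ σ are related.
--  * char τ is the characteristic of the orbit f(τ) of Q/R, i.e. the
--    nonnegative generator of the stabiliser {c | f(0_τ) + c = f(0_τ)}
--    = {c | (τ,0) R (τ,c)}.
--  * for τ sim σ, diff τ σ is an integer representative of f(0_σ) - f(0_τ),
--    i.e. f(0_σ) = f(0_τ) + diff τ σ = f((τ , diff τ σ)).
record IsSignatureOf {n : ℕ} (R : QRel n) (Φ : SigData n) : Set where
  open SigData Φ
  field
    sim-type  : ∀ τ σ → sim τ σ ⇔ (∃[ i ] ∃[ j ] R τ i σ j)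
    char-stab : ∀ τ (c : ℤ) → R τ (+ 0) τ c ⇔ ((+ char τ) ∣ c)
    diff-rep  : ∀ {τ σ} → sim τ σ → R σ (+ 0) τ (diff τ σ)

-- Given an equivalence signature Φ = (∼, diff, char)
-- we define
--     (τ , i) ≡Φ (σ , j)   iff   τ ∼ σ  and  diff τ σ + j ≡ i  (mod char τ),
-- i.e. (σ , j) sits at offset diff τ σ + j in the "coordinates" of τ, and
-- two points are identified when their offsets agree modulo the
-- characteristic of their common class.
--
-- For the converse, if Φ is a signature of R then, by
-- equivariance, (τ , i) R (τ , i') iff i' ≡ i (mod char τ) (the stabiliser),
-- and (σ , j) R (τ , diff τ σ + j) (the diff representative translated);
-- composing the two shows that R and ≡Φ coincide.
module Submission where

open import Defs
open import Data.Nat using (ℕ)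
open import Data.Integer using (ℤ; +_; _+_; _-_; -_)
open import Data.Integer.Properties using (+-identityˡ; +-assoc)
open import Data.Integer.Divisibility.Signed
  using (divides; ∣ᵤ⇒∣; ∣⇒∣ᵤ; ∣-trans; ∣m∣n⇒∣m+n; ∣m⇒∣-m)
  renaming (_∣_ to _∣ₛ_)
open import Data.Integer.Tactic.RingSolver using (solve-∀)
open import Data.Fin using (Fin)
open import Data.Product using (Σ; _×_; _,_)
open import Function.Bundles using (_⇔_; mk⇔; Equivalence)
open import Relation.Binary.Bundles using (Setoid)
open import Relation.Binary.PropositionalEquality
  using (_≡_; refl; subst; sym)
import Relation.Binary.Reasoning.Setoid as SetoidReasoning

infix 4 _≈[_]_

-- a ≡ b (mod k), phrased with signed divisibility and packaged as a record:
-- _≡[mod_]_ of Defs unfolds to a statement about absolute values from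
-- which a, b and k cannot be recovered, whereas here Agda infers them from
-- a proof, so congruences compose without explicit arguments.
record _≈[_]_ (a : ℤ) (k : ℕ) (b : ℤ) : Set where
  constructor congruent
  field divides-difference : + k ∣ₛ (a - b)

fromMod : ∀ {a k b} → a ≡[mod k ] b → a ≈[ k ] b
fromMod a≡b = congruent (∣ᵤ⇒∣ a≡b)

toMod : ∀ {a k b} → a ≈[ k ] b → a ≡[mod k ] b
toMod (congruent k∣a-b) = ∣⇒∣ᵤ k∣a-b

module _ {k : ℕ} where

  ≈-by-difference : ∀ {a b c d} → a - b ≡ c - d → a ≈[ k ] b → c ≈[ k ] d
  ≈-by-difference eq (congruent k∣a-b) = congruent (subst (+ k ∣ₛ_) eq k∣a-b)

  ≈-reflexive : ∀ {a b} → a ≡ b → a ≈[ k ] b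
  ≈-reflexive {a} refl = congruent (subst (+ k ∣ₛ_) (zero-difference a) (divides (+ 0) refl))
    where
    zero-difference : ∀ a → + 0 ≡ a - a
    zero-difference = solve-∀

  ≈-sym : ∀ {a b} → a ≈[ k ] b → b ≈[ k ] a
  ≈-sym {a} {b} (congruent k∣a-b) =
    congruent (subst (+ k ∣ₛ_) (negate-difference a b) (∣m⇒∣-m k∣a-b))
    where
    negate-difference : ∀ a b → - (a - b) ≡ b - a
    negate-difference = solve-∀

  ≈-trans : ∀ {a b c} → a ≈[ k ] b → b ≈[ k ] c → a ≈[ k ] c
  ≈-trans {a} {b} {c} (congruent k∣a-b) (congruent k∣b-c) =
    congruent (subst (+ k ∣ₛ_) (telescope a b c) (∣m∣n⇒∣m+n k∣a-b k∣b-c))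
    where
    telescope : ∀ a b c → (a - b) + (b - c) ≡ a - c
    telescope = solve-∀

  ≈-+ʳ : ∀ {a b} c → a ≈[ k ] b → a + c ≈[ k ] b + c
  ≈-+ʳ {a} {b} c = ≈-by-difference (shift a b c)
    where
    shift : ∀ a b c → a - b ≡ (a + c) - (b + c)
    shift = solve-∀

  ≈-+ˡ : ∀ a {b c} → b ≈[ k ] c → a + b ≈[ k ] a + c
  ≈-+ˡ a {b} {c} = ≈-by-difference (shift a b c)
    where
    shift : ∀ a b c → b - c ≡ (a + b) - (a + c)
    shift = solve-∀

  ≈-cancelʳ : ∀ {a b} c → a + c ≈[ k ] b + c → a ≈[ k ] b
  ≈-cancelʳ {a} {b} c = ≈-by-difference (unshift a b c)
    where
    unshift : ∀ a b c → (a + c) - (b + c) ≡ a - b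
    unshift = solve-∀

≈-setoid : ℕ → Setoid _ _
≈-setoid k = record
  { Carrier       = ℤ
  ; _≈_           = _≈[ k ]_
  ; isEquivalence = record { refl = ≈-reflexive refl ; sym = ≈-sym ; trans = ≈-trans }
  }

≈-weaken : ∀ {c k a b} → + k ≈[ c ] + 0 → a ≈[ k ] b → a ≈[ c ] b
≈-weaken {c} {k} (congruent c∣k-0) (congruent k∣a-b) =
  congruent (∣-trans (subst (+ c ∣ₛ_) (minus-zero (+ k)) c∣k-0) k∣a-b)
  where
  minus-zero : ∀ a → a - + 0 ≡ a
  minus-zero = solve-∀

module _ {n : ℕ} {k : Fin n → ℕ} where

  relationOf : EquivSignature k → QRel n
  relationOf Φ τ i σ j = sim τ σ × diff τ σ + j ≈[ char τ ] i
    where open EquivSignature Φ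

  module _ (Φ : EquivSignature k) where
    open EquivSignature Φ
    open IsEquivSignature isSig

    at-class : ∀ {τ σ a b} → sim τ σ → a ≈[ char σ ] b → a ≈[ char τ ] b
    at-class {a = a} {b} s = subst (λ c → a ≈[ c ] b) (sym (char-class s))

    cocycle≈ : ∀ {τ₁ τ₂ τ₃} → sim τ₁ τ₂ → sim τ₂ τ₃ →
               diff τ₁ τ₂ + diff τ₂ τ₃ ≈[ char τ₁ ] diff τ₁ τ₃
    cocycle≈ s s' = fromMod (cocycle s s')

    -- The cocycle condition at (τ , τ , τ): an orbit has offset 0 to itself.
    diff-self : ∀ τ → diff τ τ ≈[ char τ ] + 0
    diff-self τ = ≈-cancelʳ (diff τ τ)
      (≈-trans (cocycle≈ s s) (≈-reflexive (sym (+-identityˡ (diff τ τ)))))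
      where s = sim-refl τ

    -- Since char τ divides k τ, representatives of the same element of Q
    -- are congruent modulo char τ.
    same-element : ∀ τ {i i'} → i ≡[mod k τ ] i' → i ≈[ char τ ] i'
    same-element τ i≡i' = ≈-weaken (fromMod (char-divides τ)) (fromMod i≡i')

    relationOf-refl : ∀ τ i → relationOf Φ τ i τ i
    relationOf-refl τ i = sim-refl τ , (begin
      diff τ τ + i  ≈⟨ ≈-+ʳ i (diff-self τ) ⟩
      + 0 + i       ≡⟨ +-identityˡ i ⟩
      i             ∎)
      where open SetoidReasoning (≈-setoid (char τ))

    relationOf-sym : ∀ {τ i σ j} →
                     relationOf Φ τ i σ j → relationOf Φ σ j τ i
    relationOf-sym {τ} {i} {σ} {j} (s , h) = s' , (begin
      diff σ τ + i                ≈⟨ ≈-+ˡ (diff σ τ) (≈-sym (at-class s' h)) ⟩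
      diff σ τ + (diff τ σ + j)   ≡⟨ +-assoc (diff σ τ) (diff τ σ) j ⟨
      (diff σ τ + diff τ σ) + j   ≈⟨ ≈-+ʳ j (cocycle≈ s' s) ⟩
      diff σ σ + j                ≈⟨ ≈-+ʳ j (diff-self σ) ⟩
      + 0 + j                     ≡⟨ +-identityˡ j ⟩
      j                           ∎)
      where
      s' = sim-sym s
      open SetoidReasoning (≈-setoid (char σ))

    relationOf-trans : ∀ {τ i σ j ρ l} → relationOf Φ τ i σ j →
                       relationOf Φ σ j ρ l → relationOf Φ τ i ρ l
    relationOf-trans {τ} {i} {σ} {j} {ρ} {l} (s , h) (s' , h') =
      sim-trans s s' , (begin
      diff τ ρ + l                ≈⟨ ≈-+ʳ l (≈-sym (cocycle≈ s s')) ⟩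
      (diff τ σ + diff σ ρ) + l   ≡⟨ +-assoc (diff τ σ) (diff σ ρ) l ⟩
      diff τ σ + (diff σ ρ + l)   ≈⟨ ≈-+ˡ (diff τ σ) (at-class s h') ⟩
      diff τ σ + j                ≈⟨ h ⟩
      i                           ∎)
      where open SetoidReasoning (≈-setoid (char τ))

    relationOf-wellDefined : ∀ {τ σ i i' j j'} → i ≡[mod k τ ] i' →
                             j ≡[mod k σ ] j' →
                             relationOf Φ τ i σ j → relationOf Φ τ i' σ j'
    relationOf-wellDefined {τ} {σ} {i} {i'} {j} {j'} i≡i' j≡j' (s , h) =
      s , (begin
      diff τ σ + j'  ≈⟨ ≈-+ˡ (diff τ σ) (at-class s (≈-sym (same-element σ j≡j'))) ⟩
      diff τ σ + j   ≈⟨ h ⟩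
      i              ≈⟨ same-element τ i≡i' ⟩
      i'             ∎)
      where open SetoidReasoning (≈-setoid (char τ))

    relationOf-equivariant : ∀ {τ i σ j} (z : ℤ) → relationOf Φ τ i σ j →
                             relationOf Φ τ (i + z) σ (j + z)
    relationOf-equivariant {τ} {i} {σ} {j} z (s , h) = s , (begin
      diff τ σ + (j + z)  ≡⟨ +-assoc (diff τ σ) j z ⟨
      (diff τ σ + j) + z  ≈⟨ ≈-+ʳ z h ⟩
      i + z               ∎)
      where open SetoidReasoning (≈-setoid (char τ))

    relationOf-isEquivariantEquivalence :
      IsEquivariantEquivalence k (relationOf Φ)
    relationOf-isEquivariantEquivalence = record
      { wellDefined = relationOf-wellDefined
      ; refl        = relationOf-refl
      ; sym         = relationOf-sym
      ; trans       = relationOf-trans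
      ; equivariant = relationOf-equivariant
      }

  module _ {R : QRel n} (E : IsEquivariantEquivalence k R) where
    open IsEquivariantEquivalence E
      using (wellDefined; equivariant) renaming (sym to R-sym; trans to R-trans)

    R-cong : ∀ {τ i σ j i' j'} → R τ i σ j → i ≡ i' → j ≡ j' → R τ i' σ j'
    R-cong r i≡i' j≡j' =
      wellDefined (toMod (≈-reflexive i≡i')) (toMod (≈-reflexive j≡j')) r

    module _ (Φ : EquivSignature k) (S : IsSignatureOf R (EquivSignature.dat Φ)) where
      open EquivSignature Φ using (sim; diff; char)
      open IsSignatureOf S

      -- The stabiliser condition, translated from (τ , 0) to (τ , i):
      -- (τ , i) R (τ , i') iff i' ≡ i (mod char τ).
      within-orbit : ∀ τ i i' → R τ i τ i' ⇔ i' ≈[ char τ ] i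
      within-orbit τ i i' = mk⇔ to from
        where
        self-cancel : ∀ i → i - i ≡ + 0
        self-cancel = solve-∀
        difference-add : ∀ i i' → (i' - i) + i ≡ i'
        difference-add = solve-∀
        to : R τ i τ i' → i' ≈[ char τ ] i
        to r = fromMod (Equivalence.to (char-stab τ (i' - i))
                 (R-cong (equivariant (- i) r) (self-cancel i) refl))
        from : i' ≈[ char τ ] i → R τ i τ i'
        from h = R-cong (equivariant i (Equivalence.from (char-stab τ (i' - i)) (toMod h)))
                        (+-identityˡ i) (difference-add i i')

      -- The diff representative, translated: (σ , j) R (τ , diff τ σ + j).
      anchor : ∀ {τ σ} j → sim τ σ → R σ j τ (diff τ σ + j)
      anchor j s = R-cong (equivariant j (diff-rep s)) (+-identityˡ j) refl

      relationOf-recovers : ∀ τ i σ j → relationOf Φ τ i σ j ⇔ R τ i σ j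
      relationOf-recovers τ i σ j = mk⇔ to from
        where
        to : relationOf Φ τ i σ j → R τ i σ j
        to (s , h) = R-trans (Equivalence.from (within-orbit τ i (diff τ σ + j)) h)
                             (R-sym (anchor j s))
        from : R τ i σ j → relationOf Φ τ i σ j
        from r = s , Equivalence.to (within-orbit τ i (diff τ σ + j))
                                    (R-trans r (anchor j s))
          where s = Equivalence.from (sim-type τ σ) (i , j , r)

proposition3 : (n : ℕ) (k : Fin n → ℕ) →
    Σ (EquivSignature k → QRel n) λ M →
    ((Φ : EquivSignature k) → IsEquivariantEquivalence k (M Φ)) ×
    ((R : QRel n) → IsEquivariantEquivalence k R →
    (Φ : EquivSignature k) → IsSignatureOf R (EquivSignature.dat Φ) →
    ∀ τ i σ j → M Φ τ i σ j ⇔ R τ i σ j)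
proposition3 n k =
  relationOf ,
  relationOf-isEquivariantEquivalence ,
  λ R E Φ S → relationOf-recovers E Φ S
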